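{- Let $f\colon\{0,\dots,n\}\to\mathbb{Z}$ and $g\colon\{0,\dots,m\}\to\mathbb{Z}$, with $\breve f,\breve g,\breve h,h,\Delta$ and $R_\delta$ as defined in the context. If a point $(i,j)\in\{0,\dots,n\}\times\{0,\dots,m\}$ is not in $R_{2\Delta}$, then $f(i)+g(j)>h(i+j)$.
   Context: $\breve f$ is the lower convex hull of $f$, i.e. the pointwise maximal convex function $\{0,\dots,n\}\to\mathbb{Q}$ with $\breve f\le f$; similarly $\breve g$ for $g$. Let $\Delta_f:=\max\{1,\max_i (f(i)-\breve f(i))\}$, $\Delta_g:=\max\{1,\max_j(g(j)-\breve g(j))\}$ and $\Delta:=\max\{\Delta_f,\Delta_g\}$. Let $h(k)=\min\{f(i)+g(j): i+j=k\}$ and $\breve h(k)=\min\{\breve f(i)+\breve g(j):i+j=k\}$ for $k\in\{0,\dots,n+m\}$ (with $0\le i\le n$, $0\le j\le m$). For $\delta\ge0$, a point $(i,j)\in\{0,\dots,n\}\times\{0,\dots,m\}$ is $\delta$-relevant if $\breve f(i)+\breve g(j)\le\breve h(i+j)+\delta$; $R_\delta$ is the set of $\delta$-relevant points. -}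

module Defs where

open import Data.Nat as ℕ using (ℕ; zero; suc; _∸_)
open import Data.Integer as ℤ using (ℤ; +_)
open import Data.Rational using (ℚ; _/_; _+_; _-_; _*_; _⊔_; _⊓_; _≤_; 1ℚ)
open import Data.Product using (_×_)

ℤ→ℚ : ℤ → ℚ
ℤ→ℚ z = z / 1

ℕ→ℚ : ℕ → ℚ
ℕ→ℚ k = (+ k) / 1

-- Functions on {0,…,n} are represented as ℕ → _, only values at i ≤ n matter.

Convex : ℕ → (ℕ → ℚ) → Set
Convex n F = ∀ i j k → i ℕ.< j → j ℕ.< k → k ℕ.≤ n →
  ℕ→ℚ (k ∸ i) * F j ≤ ℕ→ℚ (k ∸ j) * F i + ℕ→ℚ (j ∸ i) * F k

IsLowerHull : ℕ → (ℕ → ℤ) → (ℕ → ℚ) → Set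
IsLowerHull n f F =
  Convex n F ×
  (∀ i → i ℕ.≤ n → F i ≤ ℤ→ℚ (f i)) ×
  (∀ (C : ℕ → ℚ) → Convex n C → (∀ i → i ℕ.≤ n → C i ≤ ℤ→ℚ (f i)) →
     ∀ i → i ℕ.≤ n → C i ≤ F i)

minFrom : (ℕ → ℚ) → ℕ → ℕ → ℚ
minFrom F lo zero    = F lo
minFrom F lo (suc c) = F lo ⊓ minFrom F (suc lo) c

maxFrom : (ℕ → ℚ) → ℕ → ℕ → ℚ
maxFrom F lo zero    = F lo
maxFrom F lo (suc c) = F lo ⊔ maxFrom F (suc lo) c

-- min-plus convolution: (F ⊕ G)(k) = min { F i + G j : i + j = k, i ≤ n, j ≤ m }
-- i ranges over k ∸ m, …, min k n  (nonempty for k ≤ n + m)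
minConv : ℕ → ℕ → (ℕ → ℚ) → (ℕ → ℚ) → ℕ → ℚ
minConv n m F G k =
  minFrom (λ i → F i + G (k ∸ i)) (k ∸ m) (ℕ._⊓_ k n ∸ (k ∸ m))

hConv : ℕ → ℕ → (ℕ → ℤ) → (ℕ → ℤ) → ℕ → ℚ
hConv n m f g = minConv n m (λ i → ℤ→ℚ (f i)) (λ j → ℤ→ℚ (g j))

Δof : ℕ → (ℕ → ℤ) → (ℕ → ℚ) → ℚ
Δof n f F = 1ℚ ⊔ maxFrom (λ i → ℤ→ℚ (f i) - F i) 0 n

-- (i , j) is δ-relevant:  f̆ i + ğ j ≤ h̆ (i + j) + δ
Relevant : ℕ → ℕ → (ℕ → ℚ) → (ℕ → ℚ) → ℚ → ℕ → ℕ → Set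
Relevant n m F G δ i j = F i + G j ≤ minConv n m F G (i ℕ.+ j) + δ

{-# OPTIONS --safe #-}
-- Since f ≤ f̆ + Δ and g ≤ ğ + Δ pointwise, the min-plus convolutions satisfy
-- h ≤ h̆ + 2Δ. If (i , j) is not 2Δ-relevant, then
-- h(i + j) ≤ h̆(i + j) + 2Δ < f̆(i) + ğ(j) ≤ f(i) + g(j).
module Submission where

open import Defs
open import Data.Nat using (ℕ; _≤_)
open import Data.Integer using (ℤ)
open import Data.Rational using (ℚ; _+_; _<_; _⊔_)
open import Relation.Nullary using (¬_)

import Data.Nat as ℕ
import Data.Nat.Properties as ℕ
import Data.Rational as ℚ
import Data.Rational.Properties as ℚ
open import Algebra.Properties.Group ℚ.+-0-group using (//-rightDividesˡ)
open import Algebra.Bundles using (CommutativeMonoid)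
open import Algebra.Properties.CommutativeSemigroup
  (CommutativeMonoid.commutativeSemigroup ℚ.+-0-commutativeMonoid) using (interchange)
open import Data.Product using (_×_; _,_)
open import Data.Sum using (inj₁; inj₂)
open import Relation.Binary.PropositionalEquality using (refl; subst; sym)

p-q≤r⇒p≤q+r : ∀ {p q r} → p ℚ.- q ℚ.≤ r → p ℚ.≤ q + r
p-q≤r⇒p≤q+r {p} {q} {r} p-q≤r = begin
  p              ≡⟨ sym (//-rightDividesˡ q p) ⟩
  (p ℚ.- q) + q  ≤⟨ ℚ.+-monoˡ-≤ q p-q≤r ⟩
  r + q          ≡⟨ ℚ.+-comm r q ⟩
  q + r          ∎
  where open ℚ.≤-Reasoning

maxFrom-≥ : ∀ (F : ℕ → ℚ) lo c {i} → lo ≤ i → i ≤ lo ℕ.+ c → F i ℚ.≤ maxFrom F lo c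
maxFrom-≥ F lo ℕ.zero lo≤i i≤lo+0
  rewrite ℕ.+-identityʳ lo | ℕ.≤-antisym lo≤i i≤lo+0 = ℚ.≤-refl
maxFrom-≥ F lo (ℕ.suc c) {i} lo≤i i≤lo+c with ℕ.m≤n⇒m<n∨m≡n lo≤i
... | inj₂ refl = ℚ.p≤p⊔q (F lo) _
... | inj₁ lo<i = ℚ.≤-trans
  (maxFrom-≥ F (ℕ.suc lo) c lo<i (subst (i ≤_) (ℕ.+-suc lo c) i≤lo+c))
  (ℚ.p≤q⊔p (F lo) _)

minFrom-≤-+ : ∀ (A B : ℕ → ℚ) d lo c →
  (∀ t → lo ≤ t → t ≤ lo ℕ.+ c → A t ℚ.≤ B t + d) →
  minFrom A lo c ℚ.≤ minFrom B lo c + d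
minFrom-≤-+ A B d lo ℕ.zero A≤B+d = A≤B+d lo ℕ.≤-refl (ℕ.m≤m+n lo 0)
minFrom-≤-+ A B d lo (ℕ.suc c) A≤B+d = begin
  A lo ℚ.⊓ minFrom A (ℕ.suc lo) c             ≤⟨ ℚ.⊓-mono-≤ (A≤B+d lo ℕ.≤-refl (ℕ.m≤m+n lo _))
                                                   (minFrom-≤-+ A B d (ℕ.suc lo) c A≤B+d′) ⟩
  (B lo + d) ℚ.⊓ (minFrom B (ℕ.suc lo) c + d)  ≡⟨ sym (ℚ.mono-≤-distrib-⊓ (ℚ.+-monoˡ-≤ d) (B lo) _) ⟩
  (B lo ℚ.⊓ minFrom B (ℕ.suc lo) c) + d       ∎
  where
  open ℚ.≤-Reasoning
  A≤B+d′ : ∀ t → ℕ.suc lo ≤ t → t ≤ ℕ.suc lo ℕ.+ c → A t ℚ.≤ B t + d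
  A≤B+d′ t lo<t t≤ = A≤B+d t (ℕ.<⇒≤ lo<t) (subst (t ≤_) (sym (ℕ.+-suc lo c)) t≤)

≤+Δof : ∀ n (f : ℕ → ℤ) (F : ℕ → ℚ) {i} → i ≤ n → ℤ→ℚ (f i) ℚ.≤ F i + Δof n f F
≤+Δof n f F i≤n = p-q≤r⇒p≤q+r (ℚ.≤-trans
  (maxFrom-≥ (λ k → ℤ→ℚ (f k) ℚ.- F k) 0 n ℕ.z≤n i≤n) (ℚ.p≤q⊔p ℚ.1ℚ _))

minConv-window : ∀ n m {k t} → k ≤ n ℕ.+ m →
  k ℕ.∸ m ≤ t → t ≤ (k ℕ.∸ m) ℕ.+ (k ℕ.⊓ n ℕ.∸ (k ℕ.∸ m)) → t ≤ n × k ℕ.∸ t ≤ m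
minConv-window n m {k} {t} k≤n+m lo≤t t≤hi = t≤n , k∸t≤m
  where
  lo≤k⊓n : k ℕ.∸ m ≤ k ℕ.⊓ n
  lo≤k⊓n = ℕ.⊓-glb (ℕ.m∸n≤m k m) (subst (k ℕ.∸ m ≤_) (ℕ.m+n∸n≡m n m) (ℕ.∸-monoˡ-≤ m k≤n+m))
  t≤n : t ≤ n
  t≤n = ℕ.≤-trans (subst (t ≤_) (ℕ.m+[n∸m]≡n lo≤k⊓n) t≤hi) (ℕ.m⊓n≤n k n)
  k∸t≤m : k ℕ.∸ t ≤ m
  k∸t≤m = ℕ.m≤n+o⇒m∸n≤o k t (subst (k ≤_) (ℕ.+-comm m t)
    (ℕ.≤-trans (ℕ.m≤n+m∸n k m) (ℕ.+-monoʳ-≤ m lo≤t)))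

minConv-≤-+ : ∀ n m (F G F′ G′ : ℕ → ℚ) d e →
  (∀ i → i ≤ n → F′ i ℚ.≤ F i + d) → (∀ j → j ≤ m → G′ j ℚ.≤ G j + e) →
  ∀ {k} → k ≤ n ℕ.+ m → minConv n m F′ G′ k ℚ.≤ minConv n m F G k + (d + e)
minConv-≤-+ n m F G F′ G′ d e F′≤F+d G′≤G+e {k} k≤n+m =
  minFrom-≤-+ _ _ (d + e) (k ℕ.∸ m) _ termwise
  where
  termwise : ∀ t → k ℕ.∸ m ≤ t → t ≤ (k ℕ.∸ m) ℕ.+ (k ℕ.⊓ n ℕ.∸ (k ℕ.∸ m)) →
    F′ t + G′ (k ℕ.∸ t) ℚ.≤ (F t + G (k ℕ.∸ t)) + (d + e)
  termwise t lo≤t t≤hi with minConv-window n m k≤n+m lo≤t t≤hi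
  ... | t≤n , k∸t≤m = ℚ.≤-trans
    (ℚ.+-mono-≤ (F′≤F+d t t≤n) (G′≤G+e (k ℕ.∸ t) k∸t≤m))
    (ℚ.≤-reflexive (interchange (F t) d (G (k ℕ.∸ t)) e))

lemma4p1 : (n m : ℕ) (f g : ℕ → ℤ) (f̆ ğ : ℕ → ℚ) →
    IsLowerHull n f f̆ → IsLowerHull m g ğ →
    (i j : ℕ) → i ≤ n → j ≤ m →
    ¬ Relevant n m f̆ ğ ((Δof n f f̆ ⊔ Δof m g ğ) + (Δof n f f̆ ⊔ Δof m g ğ)) i j →
    hConv n m f g (i Data.Nat.+ j) < ℤ→ℚ (f i) + ℤ→ℚ (g j)
lemma4p1 n m f g f̆ ğ (_ , f̆≤f , _) (_ , ğ≤g , _) i j i≤n j≤m not-relevant = begin-strict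
  hConv n m f g (i ℕ.+ j)                  ≤⟨ minConv-≤-+ n m f̆ ğ _ _ Δ Δ f≤f̆+Δ g≤ğ+Δ
                                                (ℕ.+-mono-≤ i≤n j≤m) ⟩
  minConv n m f̆ ğ (i ℕ.+ j) + (Δ + Δ)      <⟨ ℚ.≰⇒> not-relevant ⟩
  f̆ i + ğ j                                ≤⟨ ℚ.+-mono-≤ (f̆≤f i i≤n) (ğ≤g j j≤m) ⟩
  ℤ→ℚ (f i) + ℤ→ℚ (g j)                    ∎
  where
  open ℚ.≤-Reasoning
  Δ : ℚ
  Δ = Δof n f f̆ ⊔ Δof m g ğ
  f≤f̆+Δ : ∀ i → i ≤ n → ℤ→ℚ (f i) ℚ.≤ f̆ i + Δ
  f≤f̆+Δ i i≤n = ℚ.≤-trans (≤+Δof n f f̆ i≤n) (ℚ.+-monoʳ-≤ (f̆ i) (ℚ.p≤p⊔q _ (Δof m g ğ)))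
  g≤ğ+Δ : ∀ j → j ≤ m → ℤ→ℚ (g j) ℚ.≤ ğ j + Δ
  g≤ğ+Δ j j≤m = ℚ.≤-trans (≤+Δof m g ğ j≤m) (ℚ.+-monoʳ-≤ (ğ j) (ℚ.p≤q⊔p (Δof n f f̆) _))
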